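{- Let $G$ be a finite group of order $n$ with identity element $e$. Then for each tuple $V\in G^n$ there is an integer $l$ with $0\le l\le n$ such that there is a $V$-diagonal of type $\mathbf e_1(\Pi(V))$ in the iterated group $G[2l]$.
   Context: Identify $G$ with $\mathcal I_n=\{1,\dots,n\}$; elements of $G^n$ are tuples and the group operation $*$ acts on tuples entrywise. A permutation is a tuple with pairwise distinct entries; $\mathcal W$ is the set of permutations. For $d\ge0$, a $U$-diagonal of type $V$ in $G[d]$ is a sequence $(W_1,\dots,W_d)\in\mathcal W^d$ with $U*W_1*\cdots*W_d=V$ entrywise (for $d=0$: $U=V$). For $V=(v_1,\dots,v_n)$, $\Pi(V)=v_1*\cdots*v_n$. $\mathbf e_1(b)$ denotes the tuple whose first entry is $b$ and all other entries are $e$. -}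

module Defs where

open import Level using (Level; _⊔_)
open import Data.Unit.Polymorphic using (⊤)
open import Data.Product using (_×_)
open import Data.Nat using (ℕ; zero; suc)
open import Data.Fin using (Fin; zero; suc)
open import Data.Vec using (Vec; []; _∷_)
open import Relation.Nullary using (¬_)
open import Relation.Binary.PropositionalEquality using (_≡_; _≢_)
import Relation.Binary.PropositionalEquality as ≡
open import Function.Bundles using (Inverse)
open import Algebra.Bundles using (Group)

module _ {c ℓ : Level} (G : Group c ℓ) where
  open Group G

  HasOrder : ℕ → Set _
  HasOrder n = Inverse setoid (≡.setoid (Fin n))

  Tuple : ℕ → Set c
  Tuple n = Fin n → Carrier

  _⊛_ : {n : ℕ} → Tuple n → Tuple n → Tuple n
  (U ⊛ W) i = U i ∙ W i

  IsPerm : {n : ℕ} → Tuple n → Set ℓ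
  IsPerm {n} W = (i j : Fin n) → i ≢ j → ¬ (W i ≈ W j)

  iterMul : {n d : ℕ} → Tuple n → Vec (Tuple n) d → Tuple n
  iterMul U []       = U
  iterMul U (W ∷ Ws) = iterMul (U ⊛ W) Ws

  AllPerm : {n d : ℕ} → Vec (Tuple n) d → Set ℓ
  AllPerm []       = ⊤
  AllPerm (W ∷ Ws) = IsPerm W × AllPerm Ws

  IsDiagonal : {n d : ℕ} → Tuple n → Tuple n → Vec (Tuple n) d → Set ℓ
  IsDiagonal {n} U V Ws =
    AllPerm Ws × ((i : Fin n) → iterMul U Ws i ≈ V i)

  Π : {n : ℕ} → Tuple n → Carrier
  Π {zero}  V = ε
  Π {suc n} V = V zero ∙ Π (λ i → V (suc i))

  e₁ : {n : ℕ} → Carrier → Tuple n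
  e₁ b zero    = b
  e₁ b (suc i) = ε

-- Fix a bijection elem : Fin n → G. For permutations π, π' of Fin n the tuples
-- (elem (π k))ₖ and (elem (π' k)⁻¹)ₖ are permutations of G, and their entrywise
-- product is ε wherever π and π' agree. Taking π a transposition and π' = π ∘ (t j)
-- (or π = π' when x = ε) makes this product x at position t, x⁻¹ at j and ε
-- elsewhere. Multiplying V by such a pair with x = V j moves V j onto position t and
-- clears position j; doing this for every j ≠ 1 leaves e₁(v₁ ∙ ⋯ ∙ vₙ) after
-- 2(n - 1) permutations.
module Submission where

open import Defs
open import Level using (Level)
open import Data.Nat using (ℕ; _≤_; _*_; zero; suc; z≤n)
open import Data.Nat.Properties using (n≤1+n; *-suc)
open import Data.Fin using (Fin; zero; suc)
open import Data.Fin.Properties using (_≟_; suc-injective)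
open import Data.Fin.Permutation using (Permutation′; _⟨$⟩ʳ_; id; transpose; _∘ₚ_)
import Data.Fin.Permutation.Components as Components
open import Data.Vec using (Vec; []; _∷_)
open import Data.Product using (Σ; ∃₂; _×_; _,_; proj₁; proj₂)
open import Data.Unit.Polymorphic using (tt)
open import Function using (_∘_)
open import Function.Bundles using (Inverse; Injection)
open import Function.Definitions using (Injective)
open import Function.Properties.Inverse using (Inverse⇒Injection; ↔⇒↣)
import Function.Construct.Symmetry as Symmetry
open import Relation.Nullary using (yes; no; contradiction)
open import Relation.Binary.PropositionalEquality as ≡ using (_≡_; _≢_)
open import Algebra.Bundles using (Group)
import Algebra.Properties.Group as GroupProperties

module _ {n : ℕ} (i j : Fin n) where

  transpose-left : Components.transpose i j i ≡ j
  transpose-left with i ≟ i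
  ... | yes _  = ≡.refl
  ... | no i≢i = contradiction ≡.refl i≢i

  transpose-right : Components.transpose i j j ≡ i
  transpose-right with j ≟ i
  ... | yes j≡i = j≡i
  ... | no _ with j ≟ j
  ...   | yes _  = ≡.refl
  ...   | no j≢j = contradiction ≡.refl j≢j

  transpose-other : ∀ {k} → k ≢ i → k ≢ j → Components.transpose i j k ≡ k
  transpose-other {k} k≢i k≢j with k ≟ i
  ... | yes k≡i = contradiction k≡i k≢i
  ... | no _ with k ≟ j
  ...   | yes k≡j = contradiction k≡j k≢j
  ...   | no _    = ≡.refl

module _ {c ℓ : Level} (G : Group c ℓ) where
  open Group G

  injective⇒IsPerm : ∀ {n} {W : Tuple G n} → Injective _≡_ _≈_ W → IsPerm G W
  injective⇒IsPerm W-injective i j i≢j Wi≈Wj = i≢j (W-injective Wi≈Wj)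

  Π-cong : ∀ {n} {U V : Tuple G n} → (∀ i → U i ≈ V i) → Π G U ≈ Π G V
  Π-cong {zero}  U≈V = refl
  Π-cong {suc n} U≈V = ∙-cong (U≈V zero) (Π-cong (U≈V ∘ suc))

module _ {c ℓ : Level} (G : Group c ℓ) {N : ℕ} (order : HasOrder G N) where
  open Group G
  open GroupProperties G using (⁻¹-injective; ⁻¹-anti-homo-\\; \\-leftDividesˡ;
    //-rightDividesʳ; identityˡ-unique; ε⁻¹≈ε)
  open import Relation.Binary.Reasoning.Setoid setoid

  elem : Fin N → Carrier
  elem = Inverse.from order

  index : Carrier → Fin N
  index = Inverse.to order

  elem-index : ∀ x → elem (index x) ≈ x
  elem-index = Inverse.strictlyInverseʳ order

  elem-injective : Injective _≡_ _≈_ elem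
  elem-injective = Injection.injective (Inverse⇒Injection (Symmetry.inverse order))

  relabel : Permutation′ N → Tuple G N
  relabel π k = elem (π ⟨$⟩ʳ k)

  relabel-IsPerm : ∀ π → IsPerm G (relabel π)
  relabel-IsPerm π = injective⇒IsPerm G (Injection.injective (↔⇒↣ π) ∘ elem-injective)

  relabel⁻¹-IsPerm : ∀ π → IsPerm G (λ k → relabel π k ⁻¹)
  relabel⁻¹-IsPerm π = injective⇒IsPerm G
    (Injection.injective (↔⇒↣ π) ∘ elem-injective ∘ ⁻¹-injective)

  IsTransfer : Fin N → Fin N → Carrier → Tuple G N → Set ℓ
  IsTransfer t j x D = (D t ≈ x) × (D j ≈ x ⁻¹) × (∀ k → k ≢ t → k ≢ j → D k ≈ ε)

  ratio : Fin N → Fin N → Carrier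
  ratio a a' = elem a // elem a'

  ratio-≈ε : ∀ {a a'} → a ≡ a' → ratio a a' ≈ ε
  ratio-≈ε ≡.refl = inverseʳ _

  relabel-pair : ∀ {t j x} (π π' : Permutation′ N) →
    IsTransfer t j x (λ k → ratio (π ⟨$⟩ʳ k) (π' ⟨$⟩ʳ k)) →
    ∃₂ λ W W' → IsPerm G W × IsPerm G W' × IsTransfer t j x (_⊛_ G W W')
  relabel-pair π π' T = relabel π , (λ k → relabel π' k ⁻¹) ,
    relabel-IsPerm π , relabel⁻¹-IsPerm π' , T

  transfer : ∀ {t j} → t ≢ j → (x : Carrier) →
    ∃₂ λ W W' → IsPerm G W × IsPerm G W' × IsTransfer t j x (_⊛_ G W W')
  transfer {t} {j} t≢j x with index (x \\ elem t) ≟ t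
  ... | yes b≡t = relabel-pair id id
    (trans (ratio-≈ε ≡.refl) (sym x≈ε) , trans (ratio-≈ε ≡.refl) (sym x⁻¹≈ε) ,
     λ _ _ _ → ratio-≈ε ≡.refl)
    where
    x⁻¹≈ε : x ⁻¹ ≈ ε
    x⁻¹≈ε = identityˡ-unique (x ⁻¹) (elem t)
      (trans (sym (elem-index _)) (reflexive (≡.cong elem b≡t)))
    x≈ε : x ≈ ε
    x≈ε = ⁻¹-injective (trans x⁻¹≈ε (sym ε⁻¹≈ε))
  ... | no b≢t = relabel-pair π π' (at-t , at-j , elsewhere)
    where
    b : Fin N
    b = index (x \\ elem t)
    π π' : Permutation′ N
    π = transpose j b
    π' = transpose t j ∘ₚ π
    π-t : π ⟨$⟩ʳ t ≡ t
    π-t = transpose-other j b t≢j (b≢t ∘ ≡.sym)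
    at-t : ratio (π ⟨$⟩ʳ t) (π' ⟨$⟩ʳ t) ≈ x
    at-t = begin
      ratio (π ⟨$⟩ʳ t) (π' ⟨$⟩ʳ t)
        ≡⟨ ≡.cong₂ ratio π-t (≡.cong (π ⟨$⟩ʳ_) (transpose-left t j)) ⟩
      ratio t (π ⟨$⟩ʳ j) ≡⟨ ≡.cong (ratio t) (transpose-left j b) ⟩
      elem t ∙ elem b ⁻¹ ≈⟨ ∙-congˡ (⁻¹-cong (elem-index _)) ⟩
      elem t ∙ (x \\ elem t) ⁻¹ ≈⟨ ∙-congˡ (⁻¹-anti-homo-\\ x (elem t)) ⟩
      elem t ∙ (elem t \\ x) ≈⟨ \\-leftDividesˡ (elem t) x ⟩
      x ∎
    at-j : ratio (π ⟨$⟩ʳ j) (π' ⟨$⟩ʳ j) ≈ x ⁻¹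
    at-j = begin
      ratio (π ⟨$⟩ʳ j) (π' ⟨$⟩ʳ j)
        ≡⟨ ≡.cong₂ ratio (transpose-left j b)
                         (≡.trans (≡.cong (π ⟨$⟩ʳ_) (transpose-right t j)) π-t) ⟩
      elem b ∙ elem t ⁻¹ ≈⟨ ∙-congʳ (elem-index _) ⟩
      (x ⁻¹ ∙ elem t) ∙ elem t ⁻¹ ≈⟨ //-rightDividesʳ (elem t) (x ⁻¹) ⟩
      x ⁻¹ ∎
    elsewhere : ∀ k → k ≢ t → k ≢ j → ratio (π ⟨$⟩ʳ k) (π' ⟨$⟩ʳ k) ≈ ε
    elsewhere k k≢t k≢j = ratio-≈ε (≡.sym (≡.cong (π ⟨$⟩ʳ_) (transpose-other t j k≢t k≢j)))

  record Gathers (t : Fin N) {k} (ι : Fin k → Fin N) (U : Tuple G N)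
                 {d} (Ws : Vec (Tuple G N) d) : Set ℓ where
    field
      all-perm   : AllPerm G Ws
      at-target  : iterMul G U Ws t ≈ U t ∙ Π G (U ∘ ι)
      at-sources : ∀ a → iterMul G U Ws (ι a) ≈ ε
      elsewhere  : ∀ i → i ≢ t → (∀ a → ι a ≢ i) → iterMul G U Ws i ≈ U i

  gather : ∀ {t k} (ι : Fin k → Fin N) → Injective _≡_ _≡_ ι → (∀ a → ι a ≢ t) →
    (U : Tuple G N) → Σ (Vec (Tuple G N) (2 * k)) (Gathers t ι U)
  gather {k = zero} ι _ _ U = [] , record
    { all-perm   = tt
    ; at-target  = sym (identityʳ _)
    ; at-sources = λ ()
    ; elsewhere  = λ _ _ _ → refl
    }
  gather {t} {suc k} ι ι-injective ι≢t U
    rewrite *-suc 2 k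
    with transfer (ι≢t zero ∘ ≡.sym) (U (ι zero))
  ... | W , W' , W-perm , W'-perm , D-t , D-j , D-elsewhere = W ∷ W' ∷ Ws , record
    { all-perm   = W-perm , W'-perm , all-perm
    ; at-target  = begin
        iterMul G U' Ws t                     ≈⟨ at-target ⟩
        U' t ∙ Π G (U' ∘ ι ∘ suc)             ≈⟨ ∙-cong U'-t (Π-cong G U'-ι∘suc) ⟩
        (U t ∙ U j) ∙ Π G (U ∘ ι ∘ suc)       ≈⟨ assoc _ _ _ ⟩
        U t ∙ Π G (U ∘ ι)                     ∎
    ; at-sources = λ
        { zero    → trans (elsewhere j (ι≢t zero) ι∘suc≢j) U'-j
        ; (suc a) → at-sources a
        }
    ; elsewhere  = λ i i≢t i∉ι →
        trans (elsewhere i i≢t (i∉ι ∘ suc)) (U'-elsewhere i≢t (i∉ι zero ∘ ≡.sym))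
    }
    where
    j : Fin N
    j = ι zero
    U' : Tuple G N
    U' = _⊛_ G (_⊛_ G U W) W'
    gathered : Σ (Vec (Tuple G N) (2 * k)) (Gathers t (ι ∘ suc) U')
    gathered = gather (ι ∘ suc) (suc-injective ∘ ι-injective) (ι≢t ∘ suc) U'
    Ws : Vec (Tuple G N) (2 * k)
    Ws = proj₁ gathered
    open Gathers (proj₂ gathered)

    U'-t : U' t ≈ U t ∙ U j
    U'-t = trans (assoc _ _ _) (∙-congˡ D-t)
    U'-j : U' j ≈ ε
    U'-j = trans (assoc _ _ _) (trans (∙-congˡ D-j) (inverseʳ _))
    U'-elsewhere : ∀ {i} → i ≢ t → i ≢ j → U' i ≈ U i
    U'-elsewhere i≢t i≢j =
      trans (assoc _ _ _) (trans (∙-congˡ (D-elsewhere _ i≢t i≢j)) (identityʳ _))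

    ι∘suc≢j : ∀ a → ι (suc a) ≢ j
    ι∘suc≢j a ι-suc-a≡j with ι-injective ι-suc-a≡j
    ... | ()
    U'-ι∘suc : ∀ a → U' (ι (suc a)) ≈ U (ι (suc a))
    U'-ι∘suc a = U'-elsewhere (ι≢t (suc a)) (ι∘suc≢j a)

proposition8 : {c ℓ : Level} (G : Group c ℓ) (n : ℕ) → HasOrder G n →
    (V : Tuple G n) →
    Σ ℕ (λ l → l ≤ n × Σ (Vec (Tuple G n) (2 * l))
      (λ Ws → IsDiagonal G V (e₁ G (Π G V)) Ws))
proposition8 G zero    order V = 0 , z≤n , [] , tt , λ ()
proposition8 G (suc m) order V = m , n≤1+n m , Ws , all-perm , λ
  { zero    → at-target
  ; (suc a) → at-sources a
  }
  where
  gathered : Σ (Vec (Tuple G (suc m)) (2 * m)) (Gathers G order zero suc V)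
  gathered = gather G order suc suc-injective (λ _ ()) V
  Ws : Vec (Tuple G (suc m)) (2 * m)
  Ws = proj₁ gathered
  open Gathers (proj₂ gathered)
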